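{- Let $k\ge 1$, $n=2^k$, $d=n/2$, and let $P$ and $H$ be BLG paths on $n$ vertices with respective edge-length vectors $(p_1,\dots,p_d)$ and $(h_1,\dots,h_d)$. If $\{i: p_i>0\}=\{i: h_i>0\}$, then $(p_1,\dots,p_d)=(h_1,\dots,h_d)$.
   Context: Vertices $[n]=\{1,\dots,n\}$ of $K_n$; the length of edge $\{i,j\}$ is $\min\{|i-j|,n-|i-j|\}\in\{1,\dots,d\}$, $d=\lfloor n/2\rfloor$. The edge-length vector of a path records, for each $i\in[d]$, the number of its edges of length $i$. For a permutation $\phi$ of $[d]$, the $g$-sequence is $g_0^{\phi}=n$, $g_i^{\phi}=\gcd(\phi(i),g_{i-1}^{\phi})$ for $1\le i\le d$. A BLG path is a Hamiltonian path of $K_n$ that is the minimum-cost Hamiltonian path for some circulant costs (edges of length $i$ cost $c_i$) with $c_{\phi(1)}<\dots<c_{\phi(d)}$ for a permutation $\phi$; its edge-length vector $t$ satisfies $t_{\phi(i)}=g_{i-1}^{\phi}-g_i^{\phi}$ for $i=1,\dots,d$. BLG paths are identified when they have the same edge-length vector. -}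

module Defs where

open import Data.Nat using (ℕ; zero; suc; _∸_; _<?_)
open import Data.Nat.GCD using (gcd)
open import Data.Fin using (Fin; toℕ; fromℕ<)
open import Data.Fin.Permutation using (Permutation′; _⟨$⟩ʳ_; _⟨$⟩ˡ_)
open import Data.Product using (∃)
open import Relation.Binary.PropositionalEquality using (_≡_)
open import Relation.Nullary using (yes; no)

-- Conventions: edge lengths 1..d are represented by Fin d, the element
-- j : Fin d standing for the length (toℕ j + 1).  A permutation φ of [d]
-- is a Permutation′ d; the paper's φ(i+1) is  toℕ (φ ⟨$⟩ʳ i) + 1.

len : {d : ℕ} → Fin d → ℕ
len j = suc (toℕ j)

-- g-sequence:  gSeq n d φ i  is the paper's  g_i^φ  (for 0 ≤ i ≤ d):
-- g_0 = n,  g_{i+1} = gcd(φ(i+1), g_i).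
-- (For i ≥ d the sequence is just kept constant; these values are never used.)
gSeq : (n d : ℕ) → Permutation′ d → ℕ → ℕ
gSeq n d φ zero = n
gSeq n d φ (suc i) with i <? d
... | yes i<d = gcd (len (φ ⟨$⟩ʳ fromℕ< i<d)) (gSeq n d φ i)
... | no _    = gSeq n d φ i

-- The edge-length vector t^φ of the BLG path determined by φ on n vertices
-- (d = ⌊n/2⌋):  t_{φ(i)} = g_{i-1} - g_i, i.e. t_ℓ = g_{j} - g_{j+1}
-- where ℓ = φ(j+1) (0-based j = φ⁻¹ ℓ).
blgVector : (n d : ℕ) → Permutation′ d → Fin d → ℕ
blgVector n d φ ℓ = gSeq n d φ (toℕ (φ ⟨$⟩ˡ ℓ)) ∸ gSeq n d φ (suc (toℕ (φ ⟨$⟩ˡ ℓ)))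

-- BLG paths are identified by their edge-length vectors.
IsBLGVector : (n d : ℕ) → (Fin d → ℕ) → Set
IsBLGVector n d t = ∃ λ (φ : Permutation′ d) → ∀ ℓ → t ℓ ≡ blgVector n d φ ℓ

{-# OPTIONS --safe #-}

-- Every g_i divides n, and when the divisors of n form a chain (as for n = 2^k) gcd(ℓ, g)
-- is either gcd(ℓ, n) or g for each divisor g of n.  Hence whenever the g-sequence drops
-- at the step of length ℓ, i.e. t_ℓ > 0, it drops to gcd(ℓ, n), and the values it attains
-- are exactly n and the gcd(ℓ, n) with t_ℓ > 0.  The value just before the drop at ℓ is
-- then the least attained value strictly above gcd(ℓ, n) in the divisibility chain, so
-- t_ℓ = (that value) - gcd(ℓ, n) depends only on the support of t.

module Submission where

open import Defs
open import Data.Nat using (ℕ; _^_; _*_; _/_; _<_; _≤_; _≤′_; ≤′-refl; ≤′-step; zero; suc; _∸_; _<?_; _≤?_; z≤n; s≤s; NonZero; ≢-nonZero)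
open import Data.Nat.Properties
  using (≤-total; ≤⇒≤′; ≤-antisym; ≰⇒>; ≮⇒≥; >⇒≢; n≤0⇒n≡0; n∸n≡0; m∸n≡0⇒m≤n; *-comm; m^n>0)
open import Data.Nat.Divisibility
open import Data.Nat.GCD using (gcd; gcd[m,n]∣m; gcd[m,n]∣n; gcd-greatest)
open import Data.Nat.Coprimality using (Coprime; coprime-divisor)
open import Data.Nat.Primality using (Prime; prime⇒irreducible; prime⇒nonZero; prime[2])
open import Data.Fin using (Fin; toℕ; fromℕ<)
open import Data.Fin.Properties using (fromℕ<-toℕ; toℕ-fromℕ<; toℕ<n)
open import Data.Fin.Permutation using (Permutation′; _⟨$⟩ʳ_; _⟨$⟩ˡ_; inverseʳ; inverseˡ)
open import Data.Product using (∃; _×_; _,_)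
open import Data.Sum as Sum using (_⊎_; inj₁; inj₂)
open import Function using (_∘_)
open import Function.Bundles using (_⇔_; Equivalence)
open import Level using (0ℓ)
open import Relation.Binary.PropositionalEquality
open import Relation.Nullary using (¬_; yes; no; contradiction)
open import Relation.Unary using (Pred; _⊆_)

DivisorChain : ℕ → Set
DivisorChain n = ∀ {a b} → a ∣ n → b ∣ n → a ∣ b ⊎ b ∣ a

prime∤⇒coprime : ∀ {p a} → Prime p → ¬ p ∣ a → Coprime a p
prime∤⇒coprime pr p∤a (i∣a , i∣p) with prime⇒irreducible pr i∣p
... | inj₁ i≡1 = i≡1
... | inj₂ refl = contradiction i∣a p∤a

^-monoʳ-∣ : ∀ p {i j} → i ≤ j → p ^ i ∣ p ^ j
^-monoʳ-∣ p {j = j} z≤n = 1∣ (p ^ j)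
^-monoʳ-∣ p (s≤s i≤j) = *-monoʳ-∣ p (^-monoʳ-∣ p i≤j)

∣p^k⇒≡p^i : ∀ {p a} k → Prime p → a ∣ p ^ k → ∃ λ i → a ≡ p ^ i
∣p^k⇒≡p^i zero _ a∣1 = 0 , ∣1⇒≡1 a∣1
∣p^k⇒≡p^i {p} {a} (suc k) pr a∣p^[1+k] with p ∣? a
... | no p∤a = ∣p^k⇒≡p^i k pr (coprime-divisor (prime∤⇒coprime pr p∤a) a∣p^[1+k])
... | yes (divides q refl)
    with ∣p^k⇒≡p^i {a = q} k pr
           (*-cancelʳ-∣ p {{prime⇒nonZero pr}} (subst (q * p ∣_) (*-comm p (p ^ k)) a∣p^[1+k]))
...    | i , refl = suc i , *-comm (p ^ i) p

prime^k-divisorChain : ∀ {p} k → Prime p → DivisorChain (p ^ k)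
prime^k-divisorChain {p} k pr a∣p^k b∣p^k with ∣p^k⇒≡p^i k pr a∣p^k | ∣p^k⇒≡p^i k pr b∣p^k
... | i , refl | j , refl = Sum.map (^-monoʳ-∣ p) (^-monoʳ-∣ p) (≤-total i j)

gcd-divisorChain : ∀ {n m} → DivisorChain n → m ∣ n → ∀ a → gcd a m ≡ gcd a n ⊎ gcd a m ≡ m
gcd-divisorChain {n} {m} chain m∣n a with chain (gcd[m,n]∣n a n) m∣n
... | inj₁ gcd[a,n]∣m = inj₁ (∣-antisym
        (gcd-greatest (gcd[m,n]∣m a m) (∣-trans (gcd[m,n]∣n a m) m∣n))
        (gcd-greatest (gcd[m,n]∣m a n) gcd[a,n]∣m))
... | inj₂ m∣gcd[a,n] = inj₂ (∣-antisym
        (gcd[m,n]∣n a m)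
        (gcd-greatest (∣-trans m∣gcd[a,n] (gcd[m,n]∣m a n)) ∣-refl))

module GValues (n d : ℕ) where

  gcdₙ : Fin d → ℕ
  gcdₙ ℓ = gcd (len ℓ) n

  GValue : Pred (Fin d) 0ℓ → ℕ → Set
  GValue S y = y ≡ n ⊎ ∃ λ ℓ → S ℓ × y ≡ gcdₙ ℓ

  GValue-mono : ∀ {S S′} → S ⊆ S′ → ∀ {y} → GValue S y → GValue S′ y
  GValue-mono _    (inj₁ y≡n)              = inj₁ y≡n
  GValue-mono S⊆S′ (inj₂ (ℓ , ℓ∈S , y≡c)) = inj₂ (ℓ , S⊆S′ ℓ∈S , y≡c)

  record LeastGValueAbove (S : Pred (Fin d) 0ℓ) (c y : ℕ) : Set where
    field
      gValue   : GValue S y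
      above    : c ∣ y
      distinct : y ≢ c
      least    : ∀ {z} → GValue S z → c ∣ z → z ≢ c → y ∣ z

  leastGValueAbove-unique : ∀ {S S′ c y y′} → S ⊆ S′ → S′ ⊆ S →
                            LeastGValueAbove S c y → LeastGValueAbove S′ c y′ → y ≡ y′
  leastGValueAbove-unique S⊆S′ S′⊆S Y Y′ = ∣-antisym
    (Y.least (GValue-mono S′⊆S Y′.gValue) Y′.above Y′.distinct)
    (Y′.least (GValue-mono S⊆S′ Y.gValue) Y.above Y.distinct)
    where
    module Y  = LeastGValueAbove Y
    module Y′ = LeastGValueAbove Y′

module GSequence (n d : ℕ) (φ : Permutation′ d) where

  g : ℕ → ℕ
  g = gSeq n d φ

  t : Fin d → ℕ
  t = blgVector n d φ

  support : Pred (Fin d) 0ℓ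
  support ℓ = 0 < t ℓ

  position : Fin d → ℕ
  position ℓ = toℕ (φ ⟨$⟩ˡ ℓ)

  g-suc-∣ : ∀ m → g (suc m) ∣ g m
  g-suc-∣ m with m <? d
  ... | yes m<d = gcd[m,n]∣n (len (φ ⟨$⟩ʳ fromℕ< m<d)) (g m)
  ... | no _    = ∣-refl

  g-∣-n : ∀ m → g m ∣ n
  g-∣-n zero    = ∣-refl
  g-∣-n (suc m) = ∣-trans (g-suc-∣ m) (g-∣-n m)

  g-antitone : ∀ {i j} → i ≤ j → g j ∣ g i
  g-antitone = antitone′ ∘ ≤⇒≤′
    where
    antitone′ : ∀ {i j} → i ≤′ j → g j ∣ g i
    antitone′ ≤′-refl         = ∣-refl
    antitone′ (≤′-step i≤′j) = ∣-trans (g-suc-∣ _) (antitone′ i≤′j)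

  g-nonZero : 0 < n → ∀ m → NonZero (g m)
  g-nonZero n>0 m = ≢-nonZero λ gm≡0 → >⇒≢ n>0 (0∣⇒≡0 (subst (_∣ n) gm≡0 (g-∣-n m)))

  g-suc-position : ∀ ℓ → g (suc (position ℓ)) ≡ gcd (len ℓ) (g (position ℓ))
  g-suc-position ℓ with position ℓ <? d
  ... | yes p<d = cong (λ j → gcd (len j) (g (position ℓ)))
                       (trans (cong (φ ⟨$⟩ʳ_) (fromℕ<-toℕ _ p<d)) (inverseʳ φ))
  ... | no p≮d  = contradiction (toℕ<n (φ ⟨$⟩ˡ ℓ)) p≮d

  g-suc-cases : ∀ m → g (suc m) ≡ g m ⊎ ∃ λ ℓ → position ℓ ≡ m
  g-suc-cases m with m <? d
  ... | no _    = inj₁ refl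
  ... | yes m<d = inj₂ (φ ⟨$⟩ʳ fromℕ< m<d , trans (cong toℕ (inverseˡ φ)) (toℕ-fromℕ< m<d))

  g-flat⇒t≡0 : ∀ {ℓ} → g (suc (position ℓ)) ≡ g (position ℓ) → t ℓ ≡ 0
  g-flat⇒t≡0 {ℓ} flat = trans (cong (g (position ℓ) ∸_) flat) (n∸n≡0 (g (position ℓ)))

  t≡0⇒g-flat : 0 < n → ∀ {ℓ} → t ℓ ≡ 0 → g (suc (position ℓ)) ≡ g (position ℓ)
  t≡0⇒g-flat n>0 {ℓ} t≡0 =
    ≤-antisym (∣⇒≤ {{g-nonZero n>0 (position ℓ)}} (g-suc-∣ _)) (m∸n≡0⇒m≤n t≡0)

module GSequenceInChain {n} (n>0 : 0 < n) (chain : DivisorChain n) (d : ℕ) (φ : Permutation′ d) where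
  open GValues n d
  open GSequence n d φ public

  g-suc-position≡gcdₙ : ∀ {ℓ} → support ℓ → g (suc (position ℓ)) ≡ gcdₙ ℓ
  g-suc-position≡gcdₙ {ℓ} t>0 with gcd-divisorChain chain (g-∣-n (position ℓ)) (len ℓ)
  ... | inj₁ gcd≡gcdₙ = trans (g-suc-position ℓ) gcd≡gcdₙ
  ... | inj₂ gcd≡g    = contradiction (g-flat⇒t≡0 (trans (g-suc-position ℓ) gcd≡g)) (>⇒≢ t>0)

  t≡g∸gcdₙ : ∀ {ℓ} → support ℓ → t ℓ ≡ g (position ℓ) ∸ gcdₙ ℓ
  t≡g∸gcdₙ {ℓ} t>0 = cong (g (position ℓ) ∸_) (g-suc-position≡gcdₙ t>0)

  g-suc-GValue : ∀ {ℓ m} → position ℓ ≡ m → GValue support (g m) → GValue support (g (suc m))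
  g-suc-GValue {ℓ} refl g∈V with 0 <? t ℓ
  ... | yes t>0 = inj₂ (ℓ , t>0 , g-suc-position≡gcdₙ t>0)
  ... | no t≯0  = subst (GValue support) (sym (t≡0⇒g-flat n>0 (n≤0⇒n≡0 (≮⇒≥ t≯0)))) g∈V

  g-GValue : ∀ m → GValue support (g m)
  g-GValue zero = inj₁ refl
  g-GValue (suc m) with g-suc-cases m
  ... | inj₁ flat         = subst (GValue support) (sym flat) (g-GValue m)
  ... | inj₂ (ℓ , pos≡m) = g-suc-GValue pos≡m (g-GValue m)

  GValue⇒attained : ∀ {y} → GValue support y → ∃ λ m → g m ≡ y
  GValue⇒attained (inj₁ refl)             = 0 , refl
  GValue⇒attained (inj₂ (ℓ , t>0 , refl)) = suc (position ℓ) , g-suc-position≡gcdₙ t>0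

  g-position-leastGValueAbove : ∀ {ℓ} → support ℓ → LeastGValueAbove support (gcdₙ ℓ) (g (position ℓ))
  g-position-leastGValueAbove {ℓ} t>0 = record
    { gValue   = g-GValue (position ℓ)
    ; above    = subst (_∣ g (position ℓ)) drop (g-suc-∣ (position ℓ))
    ; distinct = λ g≡gcdₙ → >⇒≢ t>0 (g-flat⇒t≡0 (trans drop (sym g≡gcdₙ)))
    ; least    = least
    }
    where
    drop : g (suc (position ℓ)) ≡ gcdₙ ℓ
    drop = g-suc-position≡gcdₙ t>0

    least : ∀ {z} → GValue support z → gcdₙ ℓ ∣ z → z ≢ gcdₙ ℓ → g (position ℓ) ∣ z
    least z∈V gcdₙ∣z z≢gcdₙ with GValue⇒attained z∈V
    ... | m , refl with m ≤? position ℓ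
    ...   | yes m≤pos = g-antitone m≤pos
    ...   | no m≰pos  = contradiction
                          (∣-antisym (subst (g m ∣_) drop (g-antitone (≰⇒> m≰pos))) gcdₙ∣z) z≢gcdₙ

sameSupport⇒≗ : ∀ {n d} {p h : Fin d → ℕ} → 0 < n → DivisorChain n →
                IsBLGVector n d p → IsBLGVector n d h →
                (∀ i → (0 < p i) ⇔ (0 < h i)) → ∀ i → p i ≡ h i
sameSupport⇒≗ {n} {d} {p} {h} n>0 chain (φ , p≗) (ψ , h≗) supp ℓ with 0 <? p ℓ
... | no p≯0 = trans (n≤0⇒n≡0 (≮⇒≥ p≯0)) (sym (n≤0⇒n≡0 (≮⇒≥ (p≯0 ∘ Equivalence.from (supp ℓ)))))
... | yes p>0 = begin
  p ℓ                          ≡⟨ p≗ ℓ ⟩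
  Φ.t ℓ                        ≡⟨ Φ.t≡g∸gcdₙ tφ>0 ⟩
  Φ.g (Φ.position ℓ) ∸ gcdₙ ℓ  ≡⟨ cong (_∸ gcdₙ ℓ) before-drops-agree ⟩
  Ψ.g (Ψ.position ℓ) ∸ gcdₙ ℓ  ≡⟨ Ψ.t≡g∸gcdₙ (Φ⊆Ψ tφ>0) ⟨
  Ψ.t ℓ                        ≡⟨ h≗ ℓ ⟨
  h ℓ                          ∎
  where
  open ≡-Reasoning
  open GValues n d
  module Φ = GSequenceInChain n>0 chain d φ
  module Ψ = GSequenceInChain n>0 chain d ψ

  Φ⊆Ψ : Φ.support ⊆ Ψ.support
  Φ⊆Ψ {i} = subst (0 <_) (h≗ i) ∘ Equivalence.to (supp i) ∘ subst (0 <_) (sym (p≗ i))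

  Ψ⊆Φ : Ψ.support ⊆ Φ.support
  Ψ⊆Φ {i} = subst (0 <_) (p≗ i) ∘ Equivalence.from (supp i) ∘ subst (0 <_) (sym (h≗ i))

  tφ>0 : Φ.support ℓ
  tφ>0 = subst (0 <_) (p≗ ℓ) p>0

  before-drops-agree : Φ.g (Φ.position ℓ) ≡ Ψ.g (Ψ.position ℓ)
  before-drops-agree = leastGValueAbove-unique Φ⊆Ψ Ψ⊆Φ
    (Φ.g-position-leastGValueAbove tφ>0) (Ψ.g-position-leastGValueAbove (Φ⊆Ψ tφ>0))

mainTheorem7 : (k : ℕ) → 1 ≤ k →
    (p h : Fin (2 ^ k / 2) → ℕ) →
    IsBLGVector (2 ^ k) (2 ^ k / 2) p →
    IsBLGVector (2 ^ k) (2 ^ k / 2) h →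
    (∀ i → (0 < p i) ⇔ (0 < h i)) →
    ∀ i → p i ≡ h i
mainTheorem7 k _ p h = sameSupport⇒≗ (m^n>0 2 k) (prime^k-divisorChain k prime[2])
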